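{- Let $\phi$ be the map on neutral head normal forms other than $\underline{0}$ defined by $\phi(\underline{0}\,N_1 N_2\cdots N_p) = (\lambda N_1)\,N_2\cdots N_p$ for $p\ge1$, and $\phi((S\,n)\,N_1\cdots N_p) = n\,N_1\cdots N_p$ for $p \ge 0$, where $n$ is a de Bruijn index and $N_1,\dots,N_p$ are arbitrary lambda terms. Then for every $k\ge1$, $\phi$ is a bijection from the set of neutral head normal forms of size $k+1$ onto the set of all lambda terms of size $k$. (The remaining neutral head normal form $\underline{0}$ has size $1$.)
   Context: Lambda terms in de Bruijn notation: $M ::= \underline{0} \mid S\,n \mid \lambda M \mid M\,M$ with de Bruijn indices $n ::= \underline{0}\mid S\,n$ (not necessarily closed); application is left associative. Size: $|\underline{0}|=1$, $|S\,n|=|n|+1$, $|\lambda M|=|M|+1$, $|M_1M_2|=|M_1|+|M_2|+1$. A neutral head normal form is a term of the form $d\,N_1\cdots N_p$ with $p\ge0$, $d$ a de Bruijn index and $N_1,\dots,N_p$ arbitrary lambda terms. -}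

module Defs where

open import Data.Nat using (ℕ; zero; suc; _+_)
open import Data.Product using (Σ; _×_; _,_; proj₁)
open import Relation.Binary.PropositionalEquality using (_≡_; _≢_; refl)
open import Relation.Nullary using (¬_)
open import Data.Empty using (⊥)

data Index : Set where
  Z : Index
  S : Index → Index

data Term : Set where
  var : Index → Term
  lam : Term → Term
  app : Term → Term → Term

sizeI : Index → ℕ
sizeI Z     = 1
sizeI (S n) = sizeI n + 1

size : Term → ℕ
size (var n)   = sizeI n
size (lam M)   = size M + 1
size (app M N) = size M + size N + 1

data Neutral : Term → Set where
  head  : (d : Index) → Neutral (var d)
  apply : {M : Term} → Neutral M → (N : Term) → Neutral (app M N)

φ : (M : Term) → Neutral M → M ≢ var Z → Term
φ .(var Z)     (head Z)                    ne with ne refl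
... | ()
φ .(var (S n)) (head (S n))                ne = var n
φ .(app (var Z) N) (apply (head Z) N)      ne = lam N
φ .(app (var (S n)) N) (apply (head (S n)) N) ne = app (var n) N
φ .(app (app M N₁) N) (apply (apply {M} h N₁) N) ne =
  app (φ (app M N₁) (apply h N₁) (λ ())) N

NeutralOfSize : ℕ → Set
NeutralOfSize s = Σ Term (λ M → Neutral M × size M ≡ s)

TermOfSize : ℕ → Set
TermOfSize s = Σ Term (λ M → size M ≡ s)

size≥2⇒≢0 : (k : ℕ) (M : Term) → size M ≡ suc (suc k) → M ≢ var Z
size≥2⇒≢0 k .(var Z) () refl

φ-restr : (k : ℕ) → NeutralOfSize (suc (suc k)) → Term
φ-restr k (M , h , eq) = φ M h (size≥2⇒≢0 k M eq)

-- φ has an explicit inverse on all terms: walk down the left spine of the term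
-- and at its head turn an index n into S n, or an abstraction λ N into 0 N.
-- This adds exactly one symbol, so φ⁻¹ maps terms of size k to neutral head
-- normal forms of size k + 1, and the two maps are mutually inverse.
module Submission where

open import Defs
open import Data.Nat using (ℕ; suc; _+_)
open import Data.Nat.Properties using (≡-irrelevant; +-comm; suc-injective)
open import Data.Product using (Σ; _,_; proj₁)
open import Relation.Binary.PropositionalEquality
  using (_≡_; refl; cong; cong₂; sym; trans; _≢_)
open import Relation.Nullary.Irrelevant using (Irrelevant)
open import Function.Definitions using (Bijective)
open import Function.Consequences.Propositional using (inverseᵇ⇒bijective)

Σ-≡-from-proj₁ : {A : Set} {P : A → Set} → (∀ {a} → Irrelevant (P a)) →
                 {x y : Σ A P} → proj₁ x ≡ proj₁ y → x ≡ y
Σ-≡-from-proj₁ irr {a , p} {.a , q} refl = cong (a ,_) (irr p q)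

Neutral-irrelevant : {M : Term} → Irrelevant (Neutral M)
Neutral-irrelevant (head d)    (head .d)    = refl
Neutral-irrelevant (apply h N) (apply h′ .N) = cong (λ g → apply g N) (Neutral-irrelevant h h′)

φ⁻¹ : Term → Term
φ⁻¹ (var n)   = var (S n)
φ⁻¹ (lam N)   = app (var Z) N
φ⁻¹ (app M N) = app (φ⁻¹ M) N

φ⁻¹-neutral : (T : Term) → Neutral (φ⁻¹ T)
φ⁻¹-neutral (var n)   = head (S n)
φ⁻¹-neutral (lam N)   = apply (head Z) N
φ⁻¹-neutral (app M N) = apply (φ⁻¹-neutral M) N

φ⁻¹-φ : (M : Term) (h : Neutral M) (ne : M ≢ var Z) → φ⁻¹ (φ M h ne) ≡ M
φ⁻¹-φ .(var Z)               (head Z)                  ne with () ← ne refl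
φ⁻¹-φ .(var (S n))           (head (S n))              ne = refl
φ⁻¹-φ .(app (var Z) N)       (apply (head Z) N)        ne = refl
φ⁻¹-φ .(app (var (S n)) N)   (apply (head (S n)) N)    ne = refl
φ⁻¹-φ .(app (app M N₁) N)    (apply (apply {M} h N₁) N) ne =
  cong (λ L → app L N) (φ⁻¹-φ (app M N₁) (apply h N₁) (λ ()))

φ-φ⁻¹ : (T : Term) (ne : φ⁻¹ T ≢ var Z) → φ (φ⁻¹ T) (φ⁻¹-neutral T) ne ≡ T
φ-φ⁻¹ (var n)                 ne = refl
φ-φ⁻¹ (lam N)                 ne = refl
φ-φ⁻¹ (app (var Z) N)         ne = refl
φ-φ⁻¹ (app (var (S n)) N)     ne = refl
φ-φ⁻¹ (app (lam M) N)         ne = refl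
φ-φ⁻¹ (app (app M₁ M₂) N)     ne = cong (λ L → app L N) (φ-φ⁻¹ (app M₁ M₂) (λ ()))

size-φ⁻¹ : (T : Term) → size (φ⁻¹ T) ≡ suc (size T)
size-φ⁻¹ (var n)   = +-comm (sizeI n) 1
size-φ⁻¹ (lam N)   = refl
size-φ⁻¹ (app M N) = cong (λ s → s + size N + 1) (size-φ⁻¹ M)

size-φ : (M : Term) (h : Neutral M) (ne : M ≢ var Z) → suc (size (φ M h ne)) ≡ size M
size-φ M h ne = trans (sym (size-φ⁻¹ (φ M h ne))) (cong size (φ⁻¹-φ M h ne))

φ⁻¹-restr : (j : ℕ) → TermOfSize (suc j) → NeutralOfSize (suc (suc j))
φ⁻¹-restr j (T , e) = φ⁻¹ T , φ⁻¹-neutral T , trans (size-φ⁻¹ T) (cong suc e)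

NeutralOfSize-≡ : {s : ℕ} {x y : NeutralOfSize s} → proj₁ x ≡ proj₁ y → x ≡ y
NeutralOfSize-≡ = Σ-≡-from-proj₁ λ (h , e) (h′ , e′) →
  cong₂ _,_ (Neutral-irrelevant h h′) (≡-irrelevant e e′)

TermOfSize-≡ : {s : ℕ} {x y : TermOfSize s} → proj₁ x ≡ proj₁ y → x ≡ y
TermOfSize-≡ = Σ-≡-from-proj₁ ≡-irrelevant

proposition6 : (j : ℕ) →
    Σ ((N : NeutralOfSize (suc (suc j))) → size (φ-restr j N) ≡ suc j)
      (λ sz → Bijective {A = NeutralOfSize (suc (suc j))} {B = TermOfSize (suc j)}
        _≡_ _≡_ (λ N → (φ-restr j N , sz N)))
proposition6 j = sz , inverseᵇ⇒bijective (inverseˡ , inverseʳ)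
  where
  sz : (N : NeutralOfSize (suc (suc j))) → size (φ-restr j N) ≡ suc j
  sz (M , h , e) = suc-injective (trans (size-φ M h _) e)

  inverseˡ : ∀ {y x} → x ≡ φ⁻¹-restr j y → (φ-restr j x , sz x) ≡ y
  inverseˡ {T , _} refl = TermOfSize-≡ (φ-φ⁻¹ T _)

  inverseʳ : ∀ {x y} → y ≡ (φ-restr j x , sz x) → φ⁻¹-restr j y ≡ x
  inverseʳ {M , h , _} refl = NeutralOfSize-≡ (φ⁻¹-φ M h _)
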